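{- Let $n\ge 1$. Let $\rho\circ\gamma: S_1\times S_{n-1}\to \mathrm{plane}(n)$ be the composite map defined below. Then: (1) $\rho\circ\gamma$ restricts to a bijection from the set of $213$-avoiding permutations in $S_1\times S_{n-1}$ to $\mathrm{plane}(n)$, with inverse $\gamma^{ -1}\circ\varepsilon$; (2) $\rho\circ\gamma$ restricts to a bijection from the set of $312$-avoiding permutations in $S_1\times S_{n-1}$ to $\mathrm{plane}(n)$, with inverse $\gamma^{ -1}\circ\omega$.
   Context: $S_1\times S_{n-1}$ denotes the set of permutations $\alpha$ of $\{1,\dots,n\}$ with $\alpha(1)=1$, written in one-line notation $\alpha(1)\alpha(2)\cdots\alpha(n)$. An inversion of $\alpha$ is a pair of positions $(i,j)$ with $i<j$ and $\alpha(i)>\alpha(j)$; the first inversion from position $i$ (if any) is the inversion $(i,j)$ with $j$ minimal. The first inversion tree $\gamma(\alpha)$ is the rooted tree on vertices labelled $1,\dots,n$ with root $1$, in which for each label $i\ne 1$ the parent of $i$ is $j$ if $(\alpha^{ -1}(i),\alpha^{ -1}(j))$ is the first inversion from position $\alpha^{ -1}(i)$, and is $1$ if there is no inversion from position $\alpha^{ -1}(i)$. It is an increasing tree (labels increase from parent to child), and $\gamma$ is a bijection from $S_1\times S_{n-1}$ onto the set $\mathrm{inc}(n)$ of increasing trees on labels $1,\dots,n$ with root $1$. A plane tree is a rooted tree in which the children of each vertex are linearly ordered left to right; $\mathrm{plane}(n)$ is the set of (unlabelled) plane trees with $n$ vertices. For $T\in\mathrm{inc}(n)$, $\rho(T)$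 is the plane tree obtained by ordering the children of each vertex left to right by increasing label. The eastpush-labelling $\varepsilon(T)\in\mathrm{inc}(n)$ of a plane tree $T$ is produced by: start with an empty stack and counter $i=1$; push the root, labelling it $i$, and increment $i$; while the stack is nonempty, pop a vertex and, for each of its children from left to right, push the child, labelling it $i$, and increment $i$. The westpop-labelling $\omega(T)\in\mathrm{inc}(n)$ is produced by: start with a stack containing only the root and $i=1$; while the stack is nonempty, pop a vertex, labelling it $i$, increment $i$, and push its children from right to left. A permutation $\alpha$ avoids $213$ (resp. $312$) if there are no positions $i<j<k$ with $\alpha(i),\alpha(j),\alpha(k)$ in the same relative order as $2,1,3$ (resp. $3,1,2$). -}

module Defs where

open import Data.Nat using (ℕ; zero; suc; _+_; _∸_; _<_; _<ᵇ_; _≟_)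
open import Data.Bool using (if_then_else_)
open import Data.List using (List; []; _∷_; map; filter; upTo; length; lookup; _++_; reverse)
open import Data.List.Relation.Binary.Permutation.Propositional using (_↭_)
open import Data.Fin as Fin using (Fin)
open import Data.Product using (Σ; _×_; _,_)
open import Relation.Nullary using (¬_)
open import Relation.Binary.PropositionalEquality using (_≡_)

oneTo : ℕ → List ℕ
oneTo n = map suc (upTo n)

twoTo : ℕ → List ℕ
twoTo n = map (2 +_) (upTo (n ∸ 1))

-- α is a permutation of {1,…,n} (one-line notation) with α(1) = 1
InS1Sn : ℕ → List ℕ → Set
InS1Sn n α = (α ↭ oneTo n) × Σ (List ℕ) (λ rest → α ≡ 1 ∷ rest)

Avoids213 : List ℕ → Set
Avoids213 α = ∀ (i j k : Fin (length α)) → i Fin.< j → j Fin.< k →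
  ¬ (lookup α j < lookup α i × lookup α i < lookup α k)

Avoids312 : List ℕ → Set
Avoids312 α = ∀ (i j k : Fin (length α)) → i Fin.< j → j Fin.< k →
  ¬ (lookup α j < lookup α k × lookup α k < lookup α i)

-- Increasing trees on labels 1..n with root 1, represented canonically
-- by their parent list: entry number k (0-based) is the parent of the
-- label k+2.  (So a tree on n labels is a list of length n-1.)

IncTree : Set
IncTree = List ℕ

nth : List ℕ → ℕ → ℕ
nth []       _       = 0
nth (x ∷ _)  zero    = x
nth (_ ∷ xs) (suc k) = nth xs k

parentOf : IncTree → ℕ → ℕ
parentOf ps c = nth ps (c ∸ 2)

afterOcc : ℕ → List ℕ → List ℕ
afterOcc i []       = []
afterOcc i (x ∷ xs) with x ≟ i
... | Relation.Nullary.yes _ = xs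
... | Relation.Nullary.no  _ = afterOcc i xs

firstLess : ℕ → List ℕ → ℕ
firstLess i []       = 1
firstLess i (x ∷ xs) = if x <ᵇ i then x else firstLess i xs

γ : List ℕ → IncTree
γ α = map (λ i → firstLess i (afterOcc i α)) (twoTo (length α))

data Plane : Set where
  node : List Plane → Plane

mutual
  size : Plane → ℕ
  size (node ts) = suc (sizes ts)

  sizes : List Plane → ℕ
  sizes []       = 0
  sizes (t ∷ ts) = size t + sizes ts

-- ρ : order children of each vertex by increasing label

childrenOf : IncTree → ℕ → List ℕ
childrenOf ps v = filter (λ c → parentOf ps c ≟ v) (twoTo (suc (length ps)))

buildPlane : IncTree → ℕ → ℕ → Plane
buildPlane ps zero    v = node []
buildPlane ps (suc f) v = node (map (buildPlane ps f) (childrenOf ps v))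

ρ : IncTree → Plane
ρ ps = buildPlane ps (suc (length ps)) 1

lookupParent : List (ℕ × ℕ) → ℕ → ℕ
lookupParent []             c = 0
lookupParent ((l , p) ∷ xs) c with l ≟ c
... | Relation.Nullary.yes _ = p
... | Relation.Nullary.no  _ = lookupParent xs c

toIncTree : ℕ → List (ℕ × ℕ) → IncTree
toIncTree n prs = map (lookupParent prs) (twoTo n)

-- eastpush labelling ε
-- stack entries: (subtree , its label); state: stack, next label, recorded pairs

pushChildrenE : ℕ → List Plane → List (Plane × ℕ) → ℕ → List (ℕ × ℕ)
              → List (Plane × ℕ) × ℕ × List (ℕ × ℕ)
pushChildrenE pl []       st i prs = st , i , prs
pushChildrenE pl (c ∷ cs) st i prs = pushChildrenE pl cs ((c , i) ∷ st) (suc i) ((i , pl) ∷ prs)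

eastLoop : ℕ → List (Plane × ℕ) → ℕ → List (ℕ × ℕ) → List (ℕ × ℕ)
eastLoop zero    st i prs = prs
eastLoop (suc f) [] i prs = prs
eastLoop (suc f) ((node cs , l) ∷ st) i prs with pushChildrenE l cs st i prs
... | st' , i' , prs' = eastLoop f st' i' prs'

ε : Plane → IncTree
ε T = toIncTree (size T) (eastLoop (size T) ((T , 1) ∷ []) 2 [])

-- westpop labelling ω
-- stack entries: (subtree , label of its parent); the root's entry is unused

westLoop : ℕ → List (Plane × ℕ) → ℕ → List (ℕ × ℕ) → List (ℕ × ℕ)
westLoop zero    st i prs = prs
westLoop (suc f) [] i prs = prs
westLoop (suc f) ((node cs , p) ∷ st) i prs =
  -- pop: label it i; push children right to left, so the leftmost is on top
  westLoop f (map (λ c → c , i) cs ++ st) (suc i) ((i , p) ∷ prs)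

ω : Plane → IncTree
ω T = toIncTree (size T) (westLoop (size T) ((T , 0) ∷ []) 1 [])

-- "ρ∘γ restricts to a bijection from {α ∈ S₁×S_{n-1} | Avoid α} onto
--  plane(n), with inverse γ⁻¹∘lab".  Since γ is a bijection onto inc(n),
-- γ⁻¹(lab T) is the (unique) α with γ α ≡ lab T.

RestrictedBijection : ℕ → (List ℕ → Set) → (Plane → IncTree) → Set
RestrictedBijection n Avoid lab =
    (∀ α → InS1Sn n α → Avoid α → size (ρ (γ α)) ≡ n)
  × (∀ α β → InS1Sn n α → Avoid α → InS1Sn n β → Avoid β →
       ρ (γ α) ≡ ρ (γ β) → α ≡ β)
    -- γ⁻¹∘lab is a left inverse:  γ⁻¹ (lab (ρ (γ α))) = α, i.e. lab (ρ (γ α)) = γ α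
  × (∀ α → InS1Sn n α → Avoid α → lab (ρ (γ α)) ≡ γ α)
  × (∀ T → size T ≡ n →
       Σ (List ℕ) (λ α → InS1Sn n α × Avoid α × γ α ≡ lab T × ρ (γ α) ≡ T))

-- Label a plane forest from b on by a traversal: the first root gets b, and the subforest
-- below it and the remaining trees get two consecutive blocks of labels, the remaining trees
-- first for eastpush and last for westpop.  Listing the labels as (labels below the first
-- root) b (labels of the remaining trees) gives a word in which the first entry after a
-- label c that is smaller than c is the parent of c; so the first inversion tree of
-- 1 ∷ word is the labelled tree, and ρ forgets the labels again.  For eastpush the labels
-- below a root exceed those of the later trees, so the words avoid 213; for westpop they
-- are smaller, so the words avoid 312.  Conversely, in a 213-avoiding (312-avoiding)
-- permutation of an interval the entries before its minimum b all exceed (are all below)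
-- the entries after it, so they form exactly these two blocks, and by induction every
-- avoiding permutation is such a word.

module Submission where

open import Defs
open import Data.Bool using (T; true; false)
open import Data.Nat using (ℕ; zero; suc; _+_; _∸_; _≤_; _<_; _<ᵇ_; z≤n; s≤s; z<s; _≟_; _<?_)
open import Data.Nat.Properties
open import Data.Nat.Induction using (<-wellFounded)
open import Induction.WellFounded using (Acc; acc)
open import Data.Fin as Fin using (Fin)
open import Data.List using (List; []; _∷_; _++_; map; filter; length; lookup; upTo; applyUpTo)
open import Data.List.Properties
  using (length-++; length-++-sucʳ; length-map; ++-assoc; ++-identityʳ; map-upTo; map-cong-local;
         filter-++; filter-none; filter-accept; filter-reject)
open import Data.List.Membership.Propositional using (_∈_; _∉_)
open import Data.List.Membership.Propositional.Properties using (∈-++⁺ˡ; ∈-++⁺ʳ; ∈-++⁻; ∈-∃++; ∈-lookup)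
open import Data.List.Membership.DecPropositional _≟_ using (_∈?_)
open import Data.List.Relation.Unary.Any using (here; there; index)
open import Data.List.Relation.Unary.Any.Properties using (lookup-index)
open import Data.List.Relation.Unary.All as All using (All; []; _∷_)
open import Data.List.Relation.Unary.AllPairs using ([]; _∷_)
open import Data.List.Relation.Unary.Unique.Propositional using (Unique)
open import Data.List.Relation.Binary.Sublist.Propositional
  using (_⊆_; []; _∷_; _∷ʳ_; ⊆-refl; ⊆-trans; from∈; to∈)
open import Data.List.Relation.Binary.Sublist.Propositional.Properties using (All-resp-⊆; ∷⁻)
  renaming (++⁺ to ⊆-++⁺; ++⁺ˡ to ⊆-++⁺ˡ; ++⁺ʳ to ⊆-++⁺ʳ)
open import Data.List.Relation.Binary.Permutation.Propositional
  using (_↭_; ↭-refl; ↭-sym; ↭-trans; prep; ↭⇒↭ₛ; module PermutationReasoning)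
open import Data.List.Relation.Binary.Permutation.Propositional.Properties
  using (∈-resp-↭; ↭-length; drop-mid; drop-∷; shift; ++-comm; ++⁺; ¬x∷xs↭[])
import Data.List.Relation.Binary.Permutation.Setoid.Properties as SetoidPermutation
open import Data.Product as Product using (∃; ∃₂; _×_; _,_; proj₁; proj₂)
open import Data.Sum as Sum using (_⊎_; inj₁; inj₂; [_,_])
open import Function using (_∘_; flip)
open import Data.Nat.Tactic.RingSolver using (solve-∀)
open import Relation.Nullary using (¬_; Dec; yes; no; contradiction)
open import Relation.Binary.PropositionalEquality
  using (_≡_; _≢_; refl; sym; trans; cong; cong₂; subst; subst₂; setoid; module ≡-Reasoning)

module _ {A : Set} where

  Unique-resp-↭ : ∀ {xs ys : List A} → xs ↭ ys → Unique xs → Unique ys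
  Unique-resp-↭ p = SetoidPermutation.Unique-resp-↭ (setoid A) (↭⇒↭ₛ p)

  Unique-++⇒disjoint : ∀ {x : A} xs {ys} → Unique (xs ++ ys) → x ∈ xs → x ∉ ys
  Unique-++⇒disjoint (w ∷ xs) (w∉ ∷ _) (here refl) x∈ys = All.lookup w∉ (∈-++⁺ʳ xs x∈ys) refl
  Unique-++⇒disjoint (w ∷ xs) (_ ∷ u)  (there x∈xs) = Unique-++⇒disjoint xs u x∈xs

  filter-cong-local : ∀ {f g : A → ℕ} {v xs} → All (λ c → f c ≡ g c) xs →
    filter (λ c → f c ≟ v) xs ≡ filter (λ c → g c ≟ v) xs
  filter-cong-local [] = refl
  filter-cong-local {f} {g} {v} {x ∷ xs} (fx≡gx ∷ eqs) with f x ≟ v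
  ... | yes fx≡v = begin
    filter (λ c → f c ≟ v) (x ∷ xs) ≡⟨ filter-accept (λ c → f c ≟ v) fx≡v ⟩
    x ∷ filter (λ c → f c ≟ v) xs   ≡⟨ cong (x ∷_) (filter-cong-local eqs) ⟩
    x ∷ filter (λ c → g c ≟ v) xs   ≡⟨ filter-accept (λ c → g c ≟ v) (trans (sym fx≡gx) fx≡v) ⟨
    filter (λ c → g c ≟ v) (x ∷ xs) ∎
    where open ≡-Reasoning
  ... | no fx≢v = begin
    filter (λ c → f c ≟ v) (x ∷ xs) ≡⟨ filter-reject (λ c → f c ≟ v) fx≢v ⟩
    filter (λ c → f c ≟ v) xs       ≡⟨ filter-cong-local eqs ⟩
    filter (λ c → g c ≟ v) xs       ≡⟨ filter-reject (λ c → g c ≟ v) (fx≢v ∘ trans fx≡gx) ⟨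
    filter (λ c → g c ≟ v) (x ∷ xs) ∎
    where open ≡-Reasoning

  ⊆-++⁻ : ∀ {xs : List A} ys {zs} → xs ⊆ ys ++ zs →
    ∃₂ λ us vs → xs ≡ us ++ vs × us ⊆ ys × vs ⊆ zs
  ⊆-++⁻ []       s = [] , _ , refl , [] , s
  ⊆-++⁻ (y ∷ ys) (.y ∷ʳ s) with ⊆-++⁻ ys s
  ... | us , vs , refl , s₁ , s₂ = us , vs , refl , y ∷ʳ s₁ , s₂
  ⊆-++⁻ (y ∷ ys) (refl ∷ s) with ⊆-++⁻ ys s
  ... | us , vs , refl , s₁ , s₂ = y ∷ us , vs , refl , refl ∷ s₁ , s₂

  some-element : ∀ {xs : List A} n → length xs ≡ suc n → ∃ (_∈ xs)
  some-element {x ∷ _} n _ = x , here refl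

range : ℕ → ℕ → List ℕ
range lo zero    = []
range lo (suc m) = lo ∷ range (suc lo) m

length-range : ∀ lo m → length (range lo m) ≡ m
length-range lo zero    = refl
length-range lo (suc m) = cong suc (length-range (suc lo) m)

range-++ : ∀ lo m n → range lo (m + n) ≡ range lo m ++ range (lo + m) n
range-++ lo zero    n = cong (λ l → range l n) (sym (+-identityʳ lo))
range-++ lo (suc m) n = cong (lo ∷_) (begin
  range (suc lo) (m + n)                      ≡⟨ range-++ (suc lo) m n ⟩
  range (suc lo) m ++ range (suc lo + m) n    ≡⟨ cong (λ l → range (suc lo) m ++ range l n) (+-suc lo m) ⟨
  range (suc lo) m ++ range (lo + suc m) n    ∎)
  where open ≡-Reasoning

∈-range⁻ : ∀ {lo m c} → c ∈ range lo m → lo ≤ c × c < lo + m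
∈-range⁻ {lo} {suc m}     (here refl) = ≤-refl , m<m+n lo z<s
∈-range⁻ {lo} {suc m} {c} (there c∈) with ∈-range⁻ c∈
... | lo<c , c<lo+m = <⇒≤ lo<c , subst (c <_) (sym (+-suc lo m)) c<lo+m

below-range : ∀ {lo m c} → c < lo → c ∉ range lo m
below-range c<lo c∈ = <⇒≱ c<lo (proj₁ (∈-range⁻ c∈))

Unique-range : ∀ lo m → Unique (range lo m)
Unique-range lo zero    = []
Unique-range lo (suc m) =
  All.tabulate (λ c∈ lo≡c → below-range (s≤s (≤-reflexive (sym lo≡c))) c∈) ∷ Unique-range (suc lo) m

applyUpTo-range : ∀ (f : ℕ → ℕ) lo m → (∀ i → f i ≡ lo + i) → applyUpTo f m ≡ range lo m
applyUpTo-range f lo zero    f≗ = refl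
applyUpTo-range f lo (suc m) f≗ = cong₂ _∷_
  (trans (f≗ 0) (+-identityʳ lo))
  (applyUpTo-range (f ∘ suc) (suc lo) m (λ i → trans (f≗ (suc i)) (+-suc lo i)))

map-upTo-range : ∀ lo m → map (lo +_) (upTo m) ≡ range lo m
map-upTo-range lo m = trans (map-upTo (lo +_) m) (applyUpTo-range (lo +_) lo m (λ _ → refl))

oneTo-range : ∀ n → oneTo n ≡ range 1 n
oneTo-range = map-upTo-range 1

map-twoTo : ∀ {g f : ℕ → ℕ} m → (∀ {c} → c ∈ range 2 m → g c ≡ f c) →
  map g (twoTo (suc m)) ≡ map f (range 2 m)
map-twoTo {g} m g≗f = trans (cong (map g) (map-upTo-range 2 m)) (map-cong-local (All.tabulate g≗f))

nth-map-range : ∀ (f : ℕ → ℕ) {lo m c} → c ∈ range lo m → nth (map f (range lo m)) (c ∸ lo) ≡ f c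
nth-map-range f {lo} {suc m}         (here refl) rewrite n∸n≡0 lo = refl
nth-map-range f {lo} {suc m} {zero}  (there c∈) = contradiction (proj₁ (∈-range⁻ c∈)) λ ()
nth-map-range f {lo} {suc m} {suc c} (there c∈)
  rewrite +-∸-assoc 1 (≤-pred (proj₁ (∈-range⁻ c∈))) = nth-map-range f c∈

-- Labelled forests

data Traversal : Set where
  eastpush westpop : Traversal

-- Labelling node ds ∷ F from b on, the first root gets b, the labels of ds start at
-- childBase t b m k and those of F at restBase t b m k, where m = sizes ds and k = sizes F.
childBase restBase : Traversal → ℕ → ℕ → ℕ → ℕ
childBase eastpush b m k = suc b + k
childBase westpop  b m k = suc b
restBase  eastpush b m k = suc b
restBase  westpop  b m k = suc b + m

range-blocks : ∀ t b m k →
    range (suc b) (m + k) ≡ range (childBase t b m k) m ++ range (restBase t b m k) k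
  ⊎ range (suc b) (m + k) ≡ range (restBase t b m k) k ++ range (childBase t b m k) m
range-blocks eastpush b m k = inj₂ (trans (cong (range (suc b)) (+-comm m k)) (range-++ (suc b) k m))
range-blocks westpop  b m k = inj₁ (range-++ (suc b) m k)

module Blocks (t : Traversal) (b m k : ℕ) where

  cb rb : ℕ
  cb = childBase t b m k
  rb = restBase t b m k

  blocks-↭ : range cb m ++ range rb k ↭ range (suc b) (m + k)
  blocks-↭ with range-blocks t b m k
  ... | inj₁ eq = subst (λ xs → xs ↭ range (suc b) (m + k)) eq ↭-refl
  ... | inj₂ eq =
    subst (λ xs → range cb m ++ range rb k ↭ xs) (sym eq) (++-comm (range cb m) (range rb k))

  child⊆ : ∀ {c} → c ∈ range cb m → c ∈ range (suc b) (m + k)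
  child⊆ c∈ = ∈-resp-↭ blocks-↭ (∈-++⁺ˡ c∈)

  rest⊆ : ∀ {c} → c ∈ range rb k → c ∈ range (suc b) (m + k)
  rest⊆ c∈ = ∈-resp-↭ blocks-↭ (∈-++⁺ʳ (range cb m) c∈)

  blocks-cover : ∀ {c} → c ∈ range (suc b) (m + k) → c ∈ range cb m ⊎ c ∈ range rb k
  blocks-cover c∈ = ∈-++⁻ (range cb m) (∈-resp-↭ (↭-sym blocks-↭) c∈)

  blocks-disjoint : ∀ {c} → c ∈ range cb m → c ∉ range rb k
  blocks-disjoint =
    Unique-++⇒disjoint (range cb m) (Unique-resp-↭ (↭-sym blocks-↭) (Unique-range (suc b) (m + k)))

  above-child : ∀ {c} → c ∈ range cb m → b < c
  above-child = proj₁ ∘ ∈-range⁻ ∘ child⊆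

  above-rest : ∀ {c} → c ∈ range rb k → b < c
  above-rest = proj₁ ∘ ∈-range⁻ ∘ rest⊆

  ∉child : b ∉ range cb m
  ∉child = <-irrefl refl ∘ above-child

  ∉rest : b ∉ range rb k
  ∉rest = <-irrefl refl ∘ above-rest

  ≢child : ∀ {c} → c ∈ range cb m → c ≢ b
  ≢child c∈ refl = ∉child c∈

  ≢rest : ∀ {c} → c ∈ range rb k → c ≢ b
  ≢rest c∈ refl = ∉rest c∈

  label-cases : ∀ {c} → c ∈ range b (suc (m + k)) → c ≡ b ⊎ c ∈ range cb m ⊎ c ∈ range rb k
  label-cases (here refl) = inj₁ refl
  label-cases (there c∈)  = inj₂ (blocks-cover c∈)

  module _ {P : ℕ → Set} (P? : ∀ c → Dec (P c)) where

    filter-child : All (λ c → ¬ P c) (range rb k) →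
      filter P? (range (suc b) (m + k)) ≡ filter P? (range cb m)
    filter-child ¬P with range-blocks t b m k
    ... | inj₁ eq rewrite eq | filter-++ P? (range cb m) (range rb k) | filter-none P? ¬P = ++-identityʳ _
    ... | inj₂ eq rewrite eq | filter-++ P? (range rb k) (range cb m) | filter-none P? ¬P = refl

    filter-rest : All (λ c → ¬ P c) (range cb m) →
      filter P? (range (suc b) (m + k)) ≡ filter P? (range rb k)
    filter-rest ¬P with range-blocks t b m k
    ... | inj₁ eq rewrite eq | filter-++ P? (range cb m) (range rb k) | filter-none P? ¬P = refl
    ... | inj₂ eq rewrite eq | filter-++ P? (range rb k) (range cb m) | filter-none P? ¬P = ++-identityʳ _

word : Traversal → List Plane → ℕ → List ℕ
word t []            b = []
word t (node ds ∷ F) b =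
  word t ds (childBase t b (sizes ds) (sizes F)) ++ b ∷ word t F (restBase t b (sizes ds) (sizes F))

-- p is the parent of the roots; labels outside the forest get the junk parent 0.
parent : Traversal → List Plane → ℕ → ℕ → ℕ → ℕ
parent t []            b p c = 0
parent t (node ds ∷ F) b p c with c ≟ b | c ∈? range (childBase t b (sizes ds) (sizes F)) (sizes ds)
... | yes _ | _     = p
... | no _  | yes _ = parent t ds (childBase t b (sizes ds) (sizes F)) b c
... | no _  | no _  = parent t F (restBase t b (sizes ds) (sizes F)) p c

roots : Traversal → List Plane → ℕ → List ℕ
roots t []            b = []
roots t (node ds ∷ F) b = b ∷ roots t F (restBase t b (sizes ds) (sizes F))

children : Traversal → List Plane → ℕ → ℕ → ℕ → List ℕ
children t F b p v = filter (λ c → parent t F b p c ≟ v) (range b (sizes F))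

labelling : Traversal → Plane → IncTree
labelling t (node cs) = map (parent t cs 2 1) (range 2 (sizes cs))

treeWord : Traversal → Plane → List ℕ
treeWord t (node cs) = 1 ∷ word t cs 2

module Node (t : Traversal) (ds F : List Plane) (b : ℕ) where

  open Blocks t b (sizes ds) (sizes F) public

  parent-root : ∀ p → parent t (node ds ∷ F) b p b ≡ p
  parent-root p with b ≟ b
  ... | yes _  = refl
  ... | no b≢b = contradiction refl b≢b

  parent-child : ∀ p {c} → c ∈ range cb (sizes ds) →
    parent t (node ds ∷ F) b p c ≡ parent t ds cb b c
  parent-child p {c} c∈ with c ≟ b | c ∈? range cb (sizes ds)
  ... | yes c≡b | _       = contradiction c≡b (≢child c∈)
  ... | no _    | yes _   = refl
  ... | no _    | no c∉   = contradiction c∈ c∉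

  parent-rest : ∀ p {c} → c ∈ range rb (sizes F) →
    parent t (node ds ∷ F) b p c ≡ parent t F rb p c
  parent-rest p {c} c∈ with c ≟ b | c ∈? range cb (sizes ds)
  ... | yes c≡b | _       = contradiction c≡b (≢rest c∈)
  ... | no _    | yes c∈' = contradiction c∈ (blocks-disjoint c∈')
  ... | no _    | no _    = refl

word-↭ : ∀ t F b → word t F b ↭ range b (sizes F)
word-↭ t []            b = ↭-refl
word-↭ t (node ds ∷ F) b = begin
  word t ds cb ++ b ∷ word t F rb
    ↭⟨ ++⁺ (word-↭ t ds cb) (prep b (word-↭ t F rb)) ⟩
  range cb (sizes ds) ++ b ∷ range rb (sizes F)
    ↭⟨ shift b (range cb (sizes ds)) (range rb (sizes F)) ⟩
  b ∷ range cb (sizes ds) ++ range rb (sizes F)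
    ↭⟨ prep b blocks-↭ ⟩
  range b (sizes (node ds ∷ F)) ∎
  where
  open Node t ds F b
  open PermutationReasoning

∈-word : ∀ t F b {c} → c ∈ word t F b → c ∈ range b (sizes F)
∈-word t F b = ∈-resp-↭ (word-↭ t F b)

length-word : ∀ t F b → length (word t F b) ≡ sizes F
length-word t F b = trans (↭-length (word-↭ t F b)) (length-range b (sizes F))

word-node : ∀ t ds F b {m k} → sizes ds ≡ m → sizes F ≡ k →
  word t (node ds ∷ F) b ≡ word t ds (childBase t b m k) ++ b ∷ word t F (restBase t b m k)
word-node t ds F b refl refl = refl

-- First inversions

afterOcc-here : ∀ c ys → afterOcc c (c ∷ ys) ≡ ys
afterOcc-here c ys with c ≟ c
... | yes _  = refl
... | no c≢c = contradiction refl c≢c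

afterOcc-skip : ∀ {c} xs {ys} → All (_≢ c) xs → afterOcc c (xs ++ ys) ≡ afterOcc c ys
afterOcc-skip []       []           = refl
afterOcc-skip {c} (x ∷ xs) (x≢c ∷ ≢s) with x ≟ c
... | yes x≡c = contradiction x≡c x≢c
... | no _    = afterOcc-skip xs ≢s

firstLess-here : ∀ {c x} ys → x < c → firstLess c (x ∷ ys) ≡ x
firstLess-here {c} {x} ys x<c with x <ᵇ c | <⇒<ᵇ x<c
... | true | _ = refl

firstLess-skip : ∀ {c} xs {ys} → All (c ≤_) xs → firstLess c (xs ++ ys) ≡ firstLess c ys
firstLess-skip []       []          = refl
firstLess-skip {c} (x ∷ xs) (c≤x ∷ ≤s) with x <ᵇ c in x<ᵇc
... | true  = contradiction (<ᵇ⇒< x c (subst T (sym x<ᵇc) _)) (≤⇒≯ c≤x)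
... | false = firstLess-skip xs ≤s

firstLess-word : ∀ t F b p S {c} → c ∈ range b (sizes F) →
  (∀ {c'} → c' ∈ range b (sizes F) → firstLess c' S ≡ p) →
  firstLess c (afterOcc c (word t F b ++ S)) ≡ parent t F b p c
firstLess-word t (node ds ∷ F) b p S c∈ S→p = by-label (label-cases c∈)
  where
  open Node t ds F b
  open ≡-Reasoning

  reassoc : ∀ c →
    afterOcc c (word t (node ds ∷ F) b ++ S) ≡ afterOcc c (word t ds cb ++ b ∷ word t F rb ++ S)
  reassoc c = cong (afterOcc c) (++-assoc (word t ds cb) (b ∷ word t F rb) S)

  by-label : ∀ {c} → c ≡ b ⊎ c ∈ range cb (sizes ds) ⊎ c ∈ range rb (sizes F) →
    firstLess c (afterOcc c (word t (node ds ∷ F) b ++ S)) ≡ parent t (node ds ∷ F) b p c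
  by-label (inj₁ refl) = begin
    firstLess b (afterOcc b (word t (node ds ∷ F) b ++ S))
      ≡⟨ cong (firstLess b) (reassoc b) ⟩
    firstLess b (afterOcc b (word t ds cb ++ b ∷ word t F rb ++ S))
      ≡⟨ cong (firstLess b) (afterOcc-skip (word t ds cb) (All.tabulate (≢child ∘ ∈-word t ds cb))) ⟩
    firstLess b (afterOcc b (b ∷ word t F rb ++ S))
      ≡⟨ cong (firstLess b) (afterOcc-here b _) ⟩
    firstLess b (word t F rb ++ S)
      ≡⟨ firstLess-skip (word t F rb) (All.tabulate (<⇒≤ ∘ above-rest ∘ ∈-word t F rb)) ⟩
    firstLess b S
      ≡⟨ S→p (here refl) ⟩
    p
      ≡⟨ parent-root p ⟨
    parent t (node ds ∷ F) b p b ∎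
  by-label {c} (inj₂ (inj₁ c∈ds)) = begin
    firstLess c (afterOcc c (word t (node ds ∷ F) b ++ S))
      ≡⟨ cong (firstLess c) (reassoc c) ⟩
    firstLess c (afterOcc c (word t ds cb ++ b ∷ word t F rb ++ S))
      ≡⟨ firstLess-word t ds cb b (b ∷ word t F rb ++ S) c∈ds
           (firstLess-here (word t F rb ++ S) ∘ above-child) ⟩
    parent t ds cb b c
      ≡⟨ parent-child p c∈ds ⟨
    parent t (node ds ∷ F) b p c ∎
  by-label {c} (inj₂ (inj₂ c∈F)) = begin
    firstLess c (afterOcc c (word t (node ds ∷ F) b ++ S))
      ≡⟨ cong (firstLess c) (reassoc c) ⟩
    firstLess c (afterOcc c (word t ds cb ++ b ∷ word t F rb ++ S))
      ≡⟨ cong (firstLess c) (afterOcc-skip (word t ds cb) ≢c) ⟩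
    firstLess c (afterOcc c (b ∷ word t F rb ++ S))
      ≡⟨ cong (firstLess c) (afterOcc-skip (b ∷ []) ((≢rest c∈F ∘ sym) ∷ [])) ⟩
    firstLess c (afterOcc c (word t F rb ++ S))
      ≡⟨ firstLess-word t F rb p S c∈F (S→p ∘ there ∘ rest⊆) ⟩
    parent t F rb p c
      ≡⟨ parent-rest p c∈F ⟨
    parent t (node ds ∷ F) b p c ∎
    where
    ≢c : All (_≢ c) (word t ds cb)
    ≢c = All.tabulate λ x∈ x≡c →
      blocks-disjoint (∈-word t ds cb x∈) (subst (_∈ range rb (sizes F)) (sym x≡c) c∈F)

γ-treeWord : ∀ t T → γ (treeWord t T) ≡ labelling t T
γ-treeWord t (node cs) =
  trans (cong (λ l → map (firstLessAfter (treeWord t (node cs))) (twoTo (suc l))) (length-word t cs 2))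
        (map-twoTo (sizes cs) firstInversion)
  where
  firstLessAfter : List ℕ → ℕ → ℕ
  firstLessAfter α i = firstLess i (afterOcc i α)

  firstInversion : ∀ {c} → c ∈ range 2 (sizes cs) →
    firstLessAfter (1 ∷ word t cs 2) c ≡ parent t cs 2 1 c
  firstInversion {c} c∈ = begin
    firstLess c (afterOcc c (1 ∷ word t cs 2))
      ≡⟨ cong (firstLess c) (afterOcc-skip (1 ∷ []) (1≢c ∷ [])) ⟩
    firstLess c (afterOcc c (word t cs 2))
      ≡⟨ cong (λ w → firstLess c (afterOcc c w)) (++-identityʳ (word t cs 2)) ⟨
    firstLess c (afterOcc c (word t cs 2 ++ []))
      ≡⟨ firstLess-word t cs 2 1 [] c∈ (λ _ → refl) ⟩
    parent t cs 2 1 c ∎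
    where
    open ≡-Reasoning
    1≢c : 1 ≢ c
    1≢c refl = below-range (s≤s (s≤s z≤n)) c∈

-- Recovering the plane tree

parent-range : ∀ t F b p {c} → c ∈ range b (sizes F) →
  parent t F b p c ≡ p ⊎ parent t F b p c ∈ range b (sizes F)
parent-range t (node ds ∷ F) b p c∈ = by-label (label-cases c∈)
  where
  open Node t ds F b

  by-label : ∀ {c} → c ≡ b ⊎ c ∈ range cb (sizes ds) ⊎ c ∈ range rb (sizes F) →
    parent t (node ds ∷ F) b p c ≡ p ⊎ parent t (node ds ∷ F) b p c ∈ range b (sizes (node ds ∷ F))
  by-label (inj₁ refl) = inj₁ (parent-root p)
  by-label (inj₂ (inj₁ c∈ds)) rewrite parent-child p c∈ds =
    inj₂ ([ (λ pc≡b → subst (_∈ _) (sym pc≡b) (here refl)) , there ∘ child⊆ ]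
            (parent-range t ds cb b c∈ds))
  by-label (inj₂ (inj₂ c∈F)) rewrite parent-rest p c∈F =
    Sum.map₂ (there ∘ rest⊆) (parent-range t F rb p c∈F)

parent-≢ : ∀ t F b p {c v} → c ∈ range b (sizes F) → p ≢ v → v ∉ range b (sizes F) →
  parent t F b p c ≢ v
parent-≢ t F b p c∈ p≢v v∉ pc≡v with parent-range t F b p c∈
... | inj₁ pc≡p = p≢v (trans (sym pc≡p) pc≡v)
... | inj₂ pc∈  = v∉ (subst (_∈ _) pc≡v pc∈)

module NodeChildren (t : Traversal) (ds F : List Plane) (b p : ℕ)
                    (p∉ : p ∉ range b (sizes (node ds ∷ F))) where

  open Node t ds F b public

  private
    Q : ∀ v c → Dec (parent t (node ds ∷ F) b p c ≡ v)
    Q v c = parent t (node ds ∷ F) b p c ≟ v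

    skip-root : ∀ {v} → p ≢ v →
      children t (node ds ∷ F) b p v ≡ filter (Q v) (range (suc b) (sizes ds + sizes F))
    skip-root p≢v =
      filter-reject (Q _) {b} {range (suc b) (sizes ds + sizes F)} (p≢v ∘ trans (sym (parent-root p)))

  only-child-block : ∀ {v} → (∀ {c} → c ∈ range rb (sizes F) → parent t F rb p c ≢ v) →
    filter (Q v) (range (suc b) (sizes ds + sizes F)) ≡ children t ds cb b v
  only-child-block ≢v = trans
    (filter-child (Q _) (All.tabulate λ c∈ pc≡v → ≢v c∈ (trans (sym (parent-rest p c∈)) pc≡v)))
    (filter-cong-local (All.tabulate (parent-child p)))

  only-rest-block : ∀ {v} → (∀ {c} → c ∈ range cb (sizes ds) → parent t ds cb b c ≢ v) →
    filter (Q v) (range (suc b) (sizes ds + sizes F)) ≡ children t F rb p v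
  only-rest-block ≢v = trans
    (filter-rest (Q _) (All.tabulate λ c∈ pc≡v → ≢v c∈ (trans (sym (parent-child p c∈)) pc≡v)))
    (filter-cong-local (All.tabulate (parent-rest p)))

  p∉child : p ∉ range cb (sizes ds)
  p∉child = p∉ ∘ there ∘ child⊆

  p∉rest : p ∉ range rb (sizes F)
  p∉rest = p∉ ∘ there ∘ rest⊆

  children-root : children t (node ds ∷ F) b p b ≡ children t ds cb b b
  children-root = trans (skip-root p≢b) (only-child-block (λ c∈ → parent-≢ t F rb p c∈ p≢b ∉rest))
    where
    p≢b : p ≢ b
    p≢b refl = p∉ (here refl)

  children-child : ∀ {v} → v ∈ range cb (sizes ds) → children t (node ds ∷ F) b p v ≡ children t ds cb b v
  children-child v∈ = trans (skip-root p≢v)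
    (only-child-block (λ c∈ → parent-≢ t F rb p c∈ p≢v (blocks-disjoint v∈)))
    where
    p≢v : p ≢ _
    p≢v refl = p∉child v∈

  children-rest : ∀ {v} → v ∈ range rb (sizes F) → children t (node ds ∷ F) b p v ≡ children t F rb p v
  children-rest v∈ = trans (skip-root p≢v)
    (only-rest-block (λ c∈ → parent-≢ t ds cb b c∈ (≢rest v∈ ∘ sym) (flip blocks-disjoint v∈)))
    where
    p≢v : p ≢ _
    p≢v refl = p∉rest v∈

children-parent : ∀ t F b p → p ∉ range b (sizes F) → children t F b p p ≡ roots t F b
children-parent t []            b p p∉ = refl
children-parent t (node ds ∷ F) b p p∉ = trans
  (filter-accept (λ c → parent t (node ds ∷ F) b p c ≟ p) {b} {range (suc b) (sizes ds + sizes F)}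
     (parent-root p))
  (cong (b ∷_) (trans (only-rest-block (λ c∈ → parent-≢ t ds cb b c∈ b≢p p∉child))
                      (children-parent t F rb p p∉rest)))
  where
  open NodeChildren t ds F b p p∉
  b≢p : b ≢ p
  b≢p refl = p∉ (here refl)

buildPlane-roots : ∀ ps t F b p f → p ∉ range b (sizes F) → sizes F ≤ f →
  (∀ {v} → v ∈ range b (sizes F) → childrenOf ps v ≡ children t F b p v) →
  map (buildPlane ps f) (roots t F b) ≡ F
buildPlane-roots ps t []            b p f       _  _             _   = refl
buildPlane-roots ps t (node ds ∷ F) b p (suc f) p∉ (s≤s size≤f) ch≡ = cong₂ _∷_
  (cong node (begin
    map (buildPlane ps f) (childrenOf ps b)
      ≡⟨ cong (map (buildPlane ps f))
              (trans (ch≡ (here refl)) (trans children-root (children-parent t ds cb b ∉child))) ⟩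
    map (buildPlane ps f) (roots t ds cb)
      ≡⟨ buildPlane-roots ps t ds cb b f ∉child (≤-trans (m≤m+n _ _) size≤f)
           (λ v∈ → trans (ch≡ (there (child⊆ v∈))) (children-child v∈)) ⟩
    ds ∎))
  (buildPlane-roots ps t F rb p (suc f) p∉rest (≤-trans (m≤n+m _ _) (m≤n⇒m≤1+n size≤f))
     (λ v∈ → trans (ch≡ (there (rest⊆ v∈))) (children-rest v∈)))
  where
  open NodeChildren t ds F b p p∉
  open ≡-Reasoning

length-map-range : ∀ (f : ℕ → ℕ) lo m → length (map f (range lo m)) ≡ m
length-map-range f lo m = trans (length-map f (range lo m)) (length-range lo m)

childrenOf-map : ∀ (f : ℕ → ℕ) m v → childrenOf (map f (range 2 m)) v ≡ filter (λ c → f c ≟ v) (range 2 m)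
childrenOf-map f m v = begin
  filter (λ c → parentOf ps c ≟ v) (twoTo (suc (length ps)))
    ≡⟨ cong (λ l → filter (λ c → parentOf ps c ≟ v) (twoTo (suc l))) (length-map-range f 2 m) ⟩
  filter (λ c → parentOf ps c ≟ v) (twoTo (suc m))
    ≡⟨ cong (filter (λ c → parentOf ps c ≟ v)) (map-upTo-range 2 m) ⟩
  filter (λ c → parentOf ps c ≟ v) (range 2 m)
    ≡⟨ filter-cong-local (All.tabulate {xs = range 2 m} (nth-map-range f)) ⟩
  filter (λ c → f c ≟ v) (range 2 m) ∎
  where
  ps = map f (range 2 m)
  open ≡-Reasoning

ρ-labelling : ∀ t T → ρ (labelling t T) ≡ T
ρ-labelling t (node cs) = begin
  buildPlane ps (suc (length ps)) 1
    ≡⟨ cong (λ l → buildPlane ps (suc l) 1) (length-map-range _ 2 m) ⟩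
  node (map (buildPlane ps m) (childrenOf ps 1))
    ≡⟨ cong (node ∘ map (buildPlane ps m)) (trans (childrenOf-map _ m 1) (children-parent t cs 2 1 1∉)) ⟩
  node (map (buildPlane ps m) (roots t cs 2))
    ≡⟨ cong node (buildPlane-roots ps t cs 2 1 m 1∉ ≤-refl (λ {v} _ → childrenOf-map _ m v)) ⟩
  node cs ∎
  where
  m  = sizes cs
  ps = labelling t (node cs)
  1∉ : 1 ∉ range 2 m
  1∉ = below-range ≤-refl
  open ≡-Reasoning

lookupParent-here : ∀ c p prs → lookupParent ((c , p) ∷ prs) c ≡ p
lookupParent-here c p prs with c ≟ c
... | yes _  = refl
... | no c≢c = contradiction refl c≢c

lookupParent-there : ∀ l p prs {c} → l ≢ c → lookupParent ((l , p) ∷ prs) c ≡ lookupParent prs c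
lookupParent-there l p prs {c} l≢c with l ≟ c
... | yes l≡c = contradiction l≡c l≢c
... | no _    = refl

-- eastLoop (suc f) ((node cs , l) ∷ st) i prs unfolds to runEast f (pushChildrenE l cs st i prs).
runEast : ℕ → List (Plane × ℕ) × ℕ × List (ℕ × ℕ) → List (ℕ × ℕ)
runEast f (st , i , prs) = eastLoop f st i prs

-- The records eastLoop adds to prs once it has pushed the children cs, labelled from i on,
-- of a vertex labelled l.
eastRecords : ℕ → List Plane → ℕ → List (ℕ × ℕ) → List (ℕ × ℕ)
eastRecords l []             i prs = prs
eastRecords l (node es ∷ cs) i prs =
  eastRecords i es (suc i + sizes cs) (eastRecords l cs (suc i) ((i , l) ∷ prs))

eastLoop-push : ∀ l cs st i prs f →
  runEast (sizes cs + f) (pushChildrenE l cs st i prs) ≡ eastLoop f st (i + sizes cs) (eastRecords l cs i prs)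
eastLoop-push l []             st i prs f = cong (λ j → eastLoop f st j prs) (sym (+-identityʳ i))
eastLoop-push l (node es ∷ cs) st i prs f = begin
  runEast (sizes (node es ∷ cs) + f) pushed
    ≡⟨ cong (λ g → runEast g pushed) (fuel (sizes es) (sizes cs) f) ⟩
  runEast (sizes cs + (size (node es) + f)) pushed
    ≡⟨ eastLoop-push l cs ((node es , i) ∷ st) (suc i) ((i , l) ∷ prs) (size (node es) + f) ⟩
  runEast (sizes es + f) (pushChildrenE i es st (suc i + sizes cs) R)
    ≡⟨ eastLoop-push i es st (suc i + sizes cs) R f ⟩
  eastLoop f st (suc i + sizes cs + sizes es) (eastRecords l (node es ∷ cs) i prs)
    ≡⟨ cong (λ j → eastLoop f st j (eastRecords l (node es ∷ cs) i prs)) (counter i (sizes es) (sizes cs)) ⟩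
  eastLoop f st (i + sizes (node es ∷ cs)) (eastRecords l (node es ∷ cs) i prs) ∎
  where
  open ≡-Reasoning
  pushed = pushChildrenE l cs ((node es , i) ∷ st) (suc i) ((i , l) ∷ prs)
  R      = eastRecords l cs (suc i) ((i , l) ∷ prs)
  fuel : ∀ a k f → suc (a + k) + f ≡ k + (suc a + f)
  fuel = solve-∀
  counter : ∀ i a k → suc i + k + a ≡ i + suc (a + k)
  counter = solve-∀

eastRecords-outside : ∀ l cs i prs {c} → c ∉ range i (sizes cs) →
  lookupParent (eastRecords l cs i prs) c ≡ lookupParent prs c
eastRecords-outside l []             i prs c∉ = refl
eastRecords-outside l (node es ∷ cs) i prs c∉ = begin
  lookupParent (eastRecords i es cb (eastRecords l cs rb ((i , l) ∷ prs))) _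
    ≡⟨ eastRecords-outside i es cb _ (c∉ ∘ there ∘ child⊆) ⟩
  lookupParent (eastRecords l cs rb ((i , l) ∷ prs)) _
    ≡⟨ eastRecords-outside l cs rb _ (c∉ ∘ there ∘ rest⊆) ⟩
  lookupParent ((i , l) ∷ prs) _
    ≡⟨ lookupParent-there i l prs (λ { refl → c∉ (here refl) }) ⟩
  lookupParent prs _ ∎
  where
  open Node eastpush es cs i
  open ≡-Reasoning

eastRecords-inside : ∀ l cs i prs {c} → c ∈ range i (sizes cs) →
  lookupParent (eastRecords l cs i prs) c ≡ parent eastpush cs i l c
eastRecords-inside l (node es ∷ cs) i prs c∈ = by-label (label-cases c∈)
  where
  open Node eastpush es cs i
  R = eastRecords l cs rb ((i , l) ∷ prs)

  by-label : ∀ {c} → c ≡ i ⊎ c ∈ range cb (sizes es) ⊎ c ∈ range rb (sizes cs) →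
    lookupParent (eastRecords i es cb R) c ≡ parent eastpush (node es ∷ cs) i l c
  by-label (inj₁ refl) = trans (eastRecords-outside i es cb R ∉child)
    (trans (eastRecords-outside l cs rb _ ∉rest) (trans (lookupParent-here i l prs) (sym (parent-root l))))
  by-label (inj₂ (inj₁ c∈es)) = trans (eastRecords-inside i es cb R c∈es) (sym (parent-child l c∈es))
  by-label (inj₂ (inj₂ c∈cs)) = trans (eastRecords-outside i es cb R (flip blocks-disjoint c∈cs))
    (trans (eastRecords-inside l cs rb _ c∈cs) (sym (parent-rest l c∈cs)))

ε-labelling : ∀ T → ε T ≡ labelling eastpush T
ε-labelling (node cs) = trans (cong (λ prs → map (lookupParent prs) (twoTo (suc (sizes cs)))) loop)
                              (map-twoTo (sizes cs) (eastRecords-inside 1 cs 2 []))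
  where
  loop : eastLoop (suc (sizes cs)) ((node cs , 1) ∷ []) 2 [] ≡ eastRecords 1 cs 2 []
  loop = subst (λ g → runEast g (pushChildrenE 1 cs [] 2 []) ≡ eastRecords 1 cs 2 [])
               (+-identityʳ (sizes cs)) (eastLoop-push 1 cs [] 2 [] 0)

-- The records westLoop adds to prs while it pops the sibling trees F, labelled from i on,
-- whose parent is labelled p.
westRecords : ℕ → List Plane → ℕ → List (ℕ × ℕ) → List (ℕ × ℕ)
westRecords p []            i prs = prs
westRecords p (node ds ∷ F) i prs =
  westRecords p F (suc i + sizes ds) (westRecords i ds (suc i) ((i , p) ∷ prs))

westLoop-forest : ∀ p F st i prs f →
  westLoop (sizes F + f) (map (λ c → c , p) F ++ st) i prs ≡ westLoop f st (i + sizes F) (westRecords p F i prs)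
westLoop-forest p []            st i prs f = cong (λ j → westLoop f st j prs) (sym (+-identityʳ i))
westLoop-forest p (node ds ∷ F) st i prs f = begin
  westLoop (sizes ds + sizes F + f) (map (λ c → c , i) ds ++ st′) (suc i) ((i , p) ∷ prs)
    ≡⟨ cong (λ g → westLoop g (map (λ c → c , i) ds ++ st′) (suc i) ((i , p) ∷ prs))
            (+-assoc (sizes ds) (sizes F) f) ⟩
  westLoop (sizes ds + (sizes F + f)) (map (λ c → c , i) ds ++ st′) (suc i) ((i , p) ∷ prs)
    ≡⟨ westLoop-forest i ds st′ (suc i) ((i , p) ∷ prs) (sizes F + f) ⟩
  westLoop (sizes F + f) st′ (suc i + sizes ds) R
    ≡⟨ westLoop-forest p F st (suc i + sizes ds) R f ⟩
  westLoop f st (suc i + sizes ds + sizes F) (westRecords p (node ds ∷ F) i prs)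
    ≡⟨ cong (λ j → westLoop f st j (westRecords p (node ds ∷ F) i prs)) (counter i (sizes ds) (sizes F)) ⟩
  westLoop f st (i + sizes (node ds ∷ F)) (westRecords p (node ds ∷ F) i prs) ∎
  where
  open ≡-Reasoning
  st′ = map (λ c → c , p) F ++ st
  R   = westRecords i ds (suc i) ((i , p) ∷ prs)
  counter : ∀ i m k → suc i + m + k ≡ i + suc (m + k)
  counter = solve-∀

westRecords-outside : ∀ p F i prs {c} → c ∉ range i (sizes F) →
  lookupParent (westRecords p F i prs) c ≡ lookupParent prs c
westRecords-outside p []            i prs c∉ = refl
westRecords-outside p (node ds ∷ F) i prs c∉ = begin
  lookupParent (westRecords p F rb (westRecords i ds cb ((i , p) ∷ prs))) _
    ≡⟨ westRecords-outside p F rb _ (c∉ ∘ there ∘ rest⊆) ⟩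
  lookupParent (westRecords i ds cb ((i , p) ∷ prs)) _
    ≡⟨ westRecords-outside i ds cb _ (c∉ ∘ there ∘ child⊆) ⟩
  lookupParent ((i , p) ∷ prs) _
    ≡⟨ lookupParent-there i p prs (λ { refl → c∉ (here refl) }) ⟩
  lookupParent prs _ ∎
  where
  open Node westpop ds F i
  open ≡-Reasoning

westRecords-inside : ∀ p F i prs {c} → c ∈ range i (sizes F) →
  lookupParent (westRecords p F i prs) c ≡ parent westpop F i p c
westRecords-inside p (node ds ∷ F) i prs c∈ = by-label (label-cases c∈)
  where
  open Node westpop ds F i
  R = westRecords i ds cb ((i , p) ∷ prs)

  by-label : ∀ {c} → c ≡ i ⊎ c ∈ range cb (sizes ds) ⊎ c ∈ range rb (sizes F) →
    lookupParent (westRecords p F rb R) c ≡ parent westpop (node ds ∷ F) i p c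
  by-label (inj₁ refl) = trans (westRecords-outside p F rb R ∉rest)
    (trans (westRecords-outside i ds cb _ ∉child) (trans (lookupParent-here i p prs) (sym (parent-root p))))
  by-label (inj₂ (inj₁ c∈ds)) = trans (westRecords-outside p F rb R (blocks-disjoint c∈ds))
    (trans (westRecords-inside i ds cb _ c∈ds) (sym (parent-child p c∈ds)))
  by-label (inj₂ (inj₂ c∈F)) = trans (westRecords-inside p F rb R c∈F) (sym (parent-rest p c∈F))

ω-labelling : ∀ T → ω T ≡ labelling westpop T
ω-labelling (node cs) = trans (cong (λ prs → map (lookupParent prs) (twoTo (suc (sizes cs)))) loop)
                              (map-twoTo (sizes cs) (westRecords-inside 1 cs 2 ((1 , 0) ∷ [])))
  where
  loop : westLoop (suc (sizes cs)) ((node cs , 0) ∷ []) 1 [] ≡ westRecords 1 cs 2 ((1 , 0) ∷ [])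
  loop = subst (λ g → westLoop g ((node cs , 0) ∷ []) 1 [] ≡ westRecords 1 cs 2 ((1 , 0) ∷ []))
               (trans (+-identityʳ _) (+-identityʳ (suc (sizes cs))))
               (westLoop-forest 0 (node cs ∷ []) [] 1 [] 0)

-- Pattern avoidance

Pattern : Set₁
Pattern = ℕ → ℕ → ℕ → Set

Avoids : Pattern → List ℕ → Set
Avoids P α = ∀ {x y z} → x ∷ y ∷ z ∷ [] ⊆ α → ¬ P x y z

-- Avoids213 and Avoids312 of Defs are AvoidsAt pattern213 and AvoidsAt pattern312.
AvoidsAt : Pattern → List ℕ → Set
AvoidsAt P α = ∀ (i j k : Fin (length α)) → i Fin.< j → j Fin.< k →
  ¬ P (lookup α i) (lookup α j) (lookup α k)

pattern213 pattern312 : Pattern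
pattern213 x y z = y < x × x < z
pattern312 x y z = y < z × z < x

lookup-pair-⊆ : ∀ (α : List ℕ) {j k} → j Fin.< k → lookup α j ∷ lookup α k ∷ [] ⊆ α
lookup-pair-⊆ (a ∷ α) {Fin.zero}  {Fin.suc k} _         = refl ∷ from∈ (∈-lookup k)
lookup-pair-⊆ (a ∷ α) {Fin.suc j} {Fin.suc k} (s≤s j<k) = a ∷ʳ lookup-pair-⊆ α j<k

lookup-triple-⊆ : ∀ (α : List ℕ) {i j k} → i Fin.< j → j Fin.< k →
  lookup α i ∷ lookup α j ∷ lookup α k ∷ [] ⊆ α
lookup-triple-⊆ (a ∷ α) {Fin.zero}  {Fin.suc j} {Fin.suc k} _ (s≤s j<k) =
  refl ∷ lookup-pair-⊆ α j<k
lookup-triple-⊆ (a ∷ α) {Fin.suc i} {Fin.suc j} {Fin.suc k} (s≤s i<j) (s≤s j<k) =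
  a ∷ʳ lookup-triple-⊆ α i<j j<k

⊆-pair-lookup : ∀ {α : List ℕ} {y z} → y ∷ z ∷ [] ⊆ α →
  ∃₂ λ j k → j Fin.< k × lookup α j ≡ y × lookup α k ≡ z
⊆-pair-lookup (a ∷ʳ s) with ⊆-pair-lookup s
... | j , k , j<k , αj≡y , αk≡z = Fin.suc j , Fin.suc k , s≤s j<k , αj≡y , αk≡z
⊆-pair-lookup (refl ∷ s) = Fin.zero , Fin.suc (index (to∈ s)) , z<s , refl , sym (lookup-index (to∈ s))

Avoids⇒AvoidsAt : ∀ {P} α → Avoids P α → AvoidsAt P α
Avoids⇒AvoidsAt α av i j k i<j j<k = av (lookup-triple-⊆ α i<j j<k)

AvoidsAt⇒Avoids : ∀ {P} α → AvoidsAt P α → Avoids P α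
AvoidsAt⇒Avoids (a ∷ α) av (.a ∷ʳ s) =
  AvoidsAt⇒Avoids α (λ i j k i<j j<k → av (Fin.suc i) (Fin.suc j) (Fin.suc k) (s≤s i<j) (s≤s j<k)) s
AvoidsAt⇒Avoids (a ∷ α) av (refl ∷ s) with ⊆-pair-lookup s
... | j , k , j<k , refl , refl = av Fin.zero (Fin.suc j) (Fin.suc k) z<s (s≤s j<k)

Avoids-⊆ : ∀ {P xs ys} → xs ⊆ ys → Avoids P ys → Avoids P xs
Avoids-⊆ xs⊆ys av s = av (⊆-trans s xs⊆ys)

Avoids-∷ : ∀ {P a α} → (∀ {x y z} → P x y z → y < x) → All (a <_) α → Avoids P α →
  Avoids P (a ∷ α)
Avoids-∷ y<x a< av (refl ∷ s) p with All-resp-⊆ s a<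
... | a<y ∷ _ = <-asym a<y (y<x p)
Avoids-∷ y<x a< av (_ ∷ʳ s) = av s

word-avoids213 : ∀ F b → Avoids pattern213 (word eastpush F b)
word-avoids213 []            b ()
word-avoids213 (node ds ∷ F) b s = by-split (⊆-++⁻ (word eastpush ds cb) s)
  where
  open Node eastpush ds F b
  L = word eastpush ds cb
  R = word eastpush F rb

  L≥ : All (cb ≤_) L
  L≥ = All.tabulate (proj₁ ∘ ∈-range⁻ ∘ ∈-word eastpush ds cb)

  bR< : All (_< cb) (b ∷ R)
  bR< = s≤s (m≤m+n b (sizes F)) ∷ All.tabulate (proj₂ ∘ ∈-range⁻ ∘ ∈-word eastpush F rb)

  R> : All (b <_) R
  R> = All.tabulate (above-rest ∘ ∈-word eastpush F rb)

  by-split : ∀ {x y z} → (∃₂ λ us vs → x ∷ y ∷ z ∷ [] ≡ us ++ vs × us ⊆ L × vs ⊆ b ∷ R) →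
    ¬ pattern213 x y z
  by-split ([] , _ , refl , _ , refl ∷ s′) (y<b , _) with All-resp-⊆ s′ R>
  ... | b<y ∷ _ = <-asym y<b b<y
  by-split ([] , _ , refl , _ , _ ∷ʳ s′) = word-avoids213 F rb s′
  by-split (_ ∷ [] , _ , refl , s₁ , s₂) (_ , x<z) with All-resp-⊆ s₁ L≥ | All-resp-⊆ s₂ bR<
  ... | cb≤x ∷ [] | _ ∷ z<cb ∷ [] = <-asym x<z (<-≤-trans z<cb cb≤x)
  by-split (_ ∷ _ ∷ [] , _ , refl , s₁ , s₂) (_ , x<z) with All-resp-⊆ s₁ L≥ | All-resp-⊆ s₂ bR<
  ... | cb≤x ∷ _ ∷ [] | z<cb ∷ [] = <-asym x<z (<-≤-trans z<cb cb≤x)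
  by-split (_ ∷ _ ∷ _ ∷ [] , _ , refl , s₁ , _) = word-avoids213 ds cb s₁
  by-split (_ ∷ _ ∷ _ ∷ _ ∷ _ , _ , () , _)

word-avoids312 : ∀ F b → Avoids pattern312 (word westpop F b)
word-avoids312 []            b ()
word-avoids312 (node ds ∷ F) b s = by-split (⊆-++⁻ (word westpop ds cb) s)
  where
  open Node westpop ds F b
  L = word westpop ds cb
  R = word westpop F rb

  L> : All (b <_) L
  L> = All.tabulate (above-child ∘ ∈-word westpop ds cb)

  L< : All (_< rb) L
  L< = All.tabulate (proj₂ ∘ ∈-range⁻ ∘ ∈-word westpop ds cb)

  R≥ : All (rb ≤_) R
  R≥ = All.tabulate (proj₁ ∘ ∈-range⁻ ∘ ∈-word westpop F rb)

  R> : All (b <_) R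
  R> = All.tabulate (above-rest ∘ ∈-word westpop F rb)

  by-split : ∀ {x y z} → (∃₂ λ us vs → x ∷ y ∷ z ∷ [] ≡ us ++ vs × us ⊆ L × vs ⊆ b ∷ R) →
    ¬ pattern312 x y z
  by-split ([] , _ , refl , _ , refl ∷ s′) (_ , z<b) with All-resp-⊆ s′ R>
  ... | _ ∷ b<z ∷ [] = <-asym z<b b<z
  by-split ([] , _ , refl , _ , _ ∷ʳ s′) = word-avoids312 F rb s′
  by-split (_ ∷ [] , _ , refl , s₁ , s₂) (_ , z<x) with All-resp-⊆ s₁ L< | All-resp-⊆ (∷⁻ s₂) R≥
  ... | x<rb ∷ [] | rb≤z ∷ [] = <-asym z<x (<-≤-trans x<rb rb≤z)
  by-split (_ ∷ _ ∷ [] , _ , refl , s₁ , refl ∷ _) (y<b , _) with All-resp-⊆ s₁ L>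
  ... | _ ∷ b<y ∷ [] = <-asym y<b b<y
  by-split (_ ∷ _ ∷ [] , _ , refl , s₁ , _ ∷ʳ s₂) (_ , z<x) with All-resp-⊆ s₁ L< | All-resp-⊆ s₂ R≥
  ... | x<rb ∷ _ ∷ [] | rb≤z ∷ [] = <-asym z<x (<-≤-trans x<rb rb≤z)
  by-split (_ ∷ _ ∷ _ ∷ [] , _ , refl , s₁ , _) = word-avoids312 ds cb s₁
  by-split (_ ∷ _ ∷ _ ∷ _ ∷ _ , _ , () , _)

-- Reconstructing a forest from an avoiding word

split-range : ∀ n {lo} (xs ys : List ℕ) → length xs ≡ n → xs ++ ys ↭ range lo (n + length ys) →
  (∀ {x y} → x ∈ xs → y ∈ ys → x < y) → xs ↭ range lo n × ys ↭ range (lo + n) (length ys)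
split-range zero {lo} [] ys refl p _ =
  ↭-refl , subst (λ l → ys ↭ range l (length ys)) (sym (+-identityʳ lo)) p
split-range (suc n) {lo} xs ys len p xs<ys with ∈-++⁻ xs (∈-resp-↭ (↭-sym p) (here refl))
... | inj₂ lo∈ys = contradiction (xs<ys x∈ lo∈ys) (≤⇒≯ (proj₁ (∈-range⁻ (∈-resp-↭ p (∈-++⁺ˡ x∈)))))
  where x∈ = proj₂ (some-element n len)
... | inj₁ lo∈xs with ∈-∃++ lo∈xs
...   | A , B , refl with split-range n (A ++ B) ys len′ p′ (λ x∈ → xs<ys (reinsert x∈))
  where
  len′ : length (A ++ B) ≡ n
  len′ = suc-injective (trans (sym (length-++-sucʳ A lo B)) len)
  p′ : (A ++ B) ++ ys ↭ range (suc lo) (n + length ys)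
  p′ = subst₂ _↭_ (sym (++-assoc A B ys)) refl
         (drop-mid A [] (subst (_↭ range lo (suc n + length ys)) (++-assoc A (lo ∷ B) ys) p))
  reinsert : ∀ {x} → x ∈ A ++ B → x ∈ A ++ lo ∷ B
  reinsert x∈ = [ ∈-++⁺ˡ , ∈-++⁺ʳ A ∘ there ] (∈-++⁻ A x∈)
...     | AB↭ , ys↭ =
  ↭-trans (shift lo A B) (prep lo AB↭) , subst (λ l → ys ↭ range l (length ys)) (sym (+-suc lo n)) ys↭

pivot-⊆ : ∀ {x z : ℕ} L {b} R → x ∈ L → z ∈ R → x ∷ b ∷ z ∷ [] ⊆ L ++ b ∷ R
pivot-⊆ L R x∈ z∈ = ⊆-++⁺ (from∈ x∈) (refl ∷ from∈ z∈)

module Pivot {b n} (L R : List ℕ) (p : L ++ R ↭ range (suc b) n) {x z} (x∈ : x ∈ L) (z∈ : z ∈ R) where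

  b<x : b < x
  b<x = proj₁ (∈-range⁻ (∈-resp-↭ p (∈-++⁺ˡ x∈)))

  b<z : b < z
  b<z = proj₁ (∈-range⁻ (∈-resp-↭ p (∈-++⁺ʳ L z∈)))

  x≢z : x ≢ z
  x≢z refl = Unique-++⇒disjoint L (Unique-resp-↭ (↭-sym p) (Unique-range (suc b) n)) x∈ z∈

Separates : Traversal → Pattern → Set
Separates t P = ∀ {b L R} → L ++ R ↭ range (suc b) (length L + length R) → Avoids P (L ++ b ∷ R) →
    L ↭ range (childBase t b (length L) (length R)) (length L)
  × R ↭ range (restBase t b (length L) (length R)) (length R)

separates213 : Separates eastpush pattern213
separates213 {b} {L} {R} p av = Product.swap (split-range (length R) R L refl R++L↭ R<L)
  where
  R++L↭ : R ++ L ↭ range (suc b) (length R + length L)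
  R++L↭ = subst (λ n → R ++ L ↭ range (suc b) n) (+-comm (length L) (length R)) (↭-trans (++-comm R L) p)

  R<L : ∀ {z x} → z ∈ R → x ∈ L → z < x
  R<L {z} {x} z∈ x∈ with z <? x
  ... | yes z<x = z<x
  ... | no z≮x  = contradiction (b<x , ≤∧≢⇒< (≮⇒≥ z≮x) x≢z) (av (pivot-⊆ L R x∈ z∈))
    where open Pivot L R p x∈ z∈

separates312 : Separates westpop pattern312
separates312 {b} {L} {R} p av = split-range (length L) L R refl p L<R
  where
  L<R : ∀ {x z} → x ∈ L → z ∈ R → x < z
  L<R {x} {z} x∈ z∈ with x <? z
  ... | yes x<z = x<z
  ... | no x≮z  = contradiction (b<z , ≤∧≢⇒< (≮⇒≥ x≮z) (x≢z ∘ sym)) (av (pivot-⊆ L R x∈ z∈))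
    where open Pivot L R p x∈ z∈

word-surjective : ∀ t P → Separates t P → ∀ σ {b} → σ ↭ range b (length σ) → Avoids P σ →
  ∃ λ F → word t F b ≡ σ
word-surjective t P separates σ = go σ (<-wellFounded (length σ))
  where
  pivot : ∀ {σ b} → σ ↭ range b (length σ) → σ ≡ [] ⊎ ∃₂ λ L R → σ ≡ L ++ b ∷ R
  pivot {[]}    _ = inj₁ refl
  pivot {_ ∷ _} p = inj₂ (∈-∃++ (∈-resp-↭ (↭-sym p) (here refl)))

  go : ∀ σ {b} → Acc _<_ (length σ) → σ ↭ range b (length σ) → Avoids P σ →
    ∃ λ F → word t F b ≡ σ
  go σ {b} (acc smaller) p av with pivot p
  ... | inj₁ refl = [] , refl
  ... | inj₂ (L , R , refl) = node FL ∷ FR ,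
    trans (word-node t FL FR b (size≡ FL L wL) (size≡ FR R wR)) (cong₂ (λ u w → u ++ b ∷ w) wL wR)
    where
    len : length (L ++ b ∷ R) ≡ suc (length L + length R)
    len = trans (length-++-sucʳ L b R) (cong suc (length-++ L))

    blocks = separates (drop-mid L [] (subst (λ n → L ++ b ∷ R ↭ range b n) len p)) av

    size≡ : ∀ F' xs {b'} → word t F' b' ≡ xs → sizes F' ≡ length xs
    size≡ F' xs {b'} w≡ = trans (sym (length-word t F' b')) (cong length w≡)

    recL = go L (smaller (subst (length L <_) (sym len) (s≤s (m≤m+n (length L) (length R)))))
              (proj₁ blocks) (Avoids-⊆ (⊆-++⁺ʳ (b ∷ R) ⊆-refl) av)
    recR = go R (smaller (subst (length R <_) (sym len) (s≤s (m≤n+m (length R) (length L)))))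
              (proj₂ blocks) (Avoids-⊆ (⊆-++⁺ˡ L (b ∷ʳ ⊆-refl)) av)
    FL = proj₁ recL
    wL = proj₂ recL
    FR = proj₁ recR
    wR = proj₂ recR

treeWord-surjective : ∀ t P → Separates t P → ∀ {n α} → InS1Sn n α → Avoids P α →
  ∃ λ T → α ≡ treeWord t T × size T ≡ n
treeWord-surjective t P separates {zero}  (p , _ , refl) av = contradiction p ¬x∷xs↭[]
treeWord-surjective t P separates {suc n} (p , rest , refl) av =
  node F , cong (1 ∷_) (sym w≡) , cong suc (trans (sym (length-word t F 2)) (trans (cong length w≡) len))
  where
  rest↭ : rest ↭ range 2 n
  rest↭ = drop-∷ (subst (1 ∷ rest ↭_) (oneTo-range (suc n)) p)
  len : length rest ≡ n
  len = trans (↭-length rest↭) (length-range 2 n)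
  found = word-surjective t P separates rest (subst (λ m → rest ↭ range 2 m) (sym len) rest↭)
            (Avoids-⊆ (1 ∷ʳ ⊆-refl) av)
  F = proj₁ found
  w≡ = proj₂ found

encoding⇒restrictedBijection : ∀ n (Avoid : List ℕ → Set) (lab : Plane → IncTree) (enc : Plane → List ℕ) →
  (∀ T → InS1Sn (size T) (enc T)) → (∀ T → Avoid (enc T)) →
  (∀ T → γ (enc T) ≡ lab T) → (∀ T → ρ (lab T) ≡ T) →
  (∀ {α} → InS1Sn n α → Avoid α → ∃ λ T → α ≡ enc T × size T ≡ n) →
  RestrictedBijection n Avoid lab
encoding⇒restrictedBijection n Avoid lab enc enc∈ enc-avoids γ-enc ρ-lab decode =
  lands , injective , left-inverse , right-inverse
  where
  ργ-enc : ∀ T → ρ (γ (enc T)) ≡ T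
  ργ-enc T = trans (cong ρ (γ-enc T)) (ρ-lab T)

  lands : ∀ α → InS1Sn n α → Avoid α → size (ρ (γ α)) ≡ n
  lands α α∈ av with decode α∈ av
  ... | T , refl , size≡ = trans (cong size (ργ-enc T)) size≡

  injective : ∀ α β → InS1Sn n α → Avoid α → InS1Sn n β → Avoid β → ρ (γ α) ≡ ρ (γ β) → α ≡ β
  injective α β α∈ avα β∈ avβ eq with decode α∈ avα | decode β∈ avβ
  ... | T , refl , _ | T′ , refl , _ = cong enc (trans (sym (ργ-enc T)) (trans eq (ργ-enc T′)))

  left-inverse : ∀ α → InS1Sn n α → Avoid α → lab (ρ (γ α)) ≡ γ α
  left-inverse α α∈ av with decode α∈ av
  ... | T , refl , _ = trans (cong lab (ργ-enc T)) (sym (γ-enc T))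

  right-inverse : ∀ T → size T ≡ n → ∃ λ α → InS1Sn n α × Avoid α × γ α ≡ lab T × ρ (γ α) ≡ T
  right-inverse T refl = enc T , enc∈ T , enc-avoids T , γ-enc T , ργ-enc T

treeWord∈S1Sn : ∀ t T → InS1Sn (size T) (treeWord t T)
treeWord∈S1Sn t (node cs) =
    subst (1 ∷ word t cs 2 ↭_) (sym (oneTo-range (suc (sizes cs)))) (prep 1 (word-↭ t cs 2))
  , word t cs 2 , refl

traversal-restrictedBijection : ∀ t P → Separates t P → (∀ F b → Avoids P (word t F b)) →
  (∀ {x y z} → P x y z → y < x) → (lab : Plane → IncTree) → (∀ T → lab T ≡ labelling t T) →
  ∀ n → RestrictedBijection n (AvoidsAt P) lab
traversal-restrictedBijection t P separates word-avoids second<first lab lab≡ n =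
  encoding⇒restrictedBijection n (AvoidsAt P) lab (treeWord t) (treeWord∈S1Sn t) treeWord-avoids
    (λ T → trans (γ-treeWord t T) (sym (lab≡ T))) (λ T → trans (cong ρ (lab≡ T)) (ρ-labelling t T))
    (λ {α} α∈ av → treeWord-surjective t P separates α∈ (AvoidsAt⇒Avoids α av))
  where
  treeWord-avoids : ∀ T → AvoidsAt P (treeWord t T)
  treeWord-avoids (node cs) = Avoids⇒AvoidsAt (treeWord t (node cs))
    (Avoids-∷ second<first (All.tabulate (proj₁ ∘ ∈-range⁻ ∘ ∈-word t cs 2)) (word-avoids cs 2))

mainTheorem4 : (n : ℕ) → 1 ≤ n →
    RestrictedBijection n Avoids213 ε × RestrictedBijection n Avoids312 ω
mainTheorem4 n _ =
    traversal-restrictedBijection eastpush pattern213 separates213 word-avoids213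
      proj₁ ε ε-labelling n
  , traversal-restrictedBijection westpop pattern312 separates312 word-avoids312
      (λ (y<z , z<x) → <-trans y<z z<x) ω ω-labelling n
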